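{- Let $G$ be a connected graph and $r$ a vertex of $G$ of eccentricity $2$. Then $G$ is $r$-stackable if and only if $G$ has a matching that saturates $N_2(r)$.
   Context: The eccentricity of $r$ is $\max_v \mathrm{dist}_G(r,v)$; $N_2(r)=\{v:\mathrm{dist}_G(r,v)=2\}$. A configuration is a function $C:V(G)\to\mathbb{N}$ (numbers of cups). A cup stacking move from $u$ to $v$ is allowed when $C(u)\ge1$, $C(v)\ge1$ and $\mathrm{dist}_G(u,v)=C(u)$; it moves all cups of $u$ onto $v$. Let $\mathbf{1}$ be the configuration with one cup on every vertex. $G$ is $r$-stackable if some sequence of moves from $\mathbf{1}$ puts all cups on $r$. -}

module Defs where

open import Data.Nat using (ℕ; zero; suc; _+_; _≤_; _<_)
open import Data.Fin using (Fin)
open import Data.Product using (Σ; ∃; _×_; _,_)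
open import Relation.Nullary using (¬_)
open import Relation.Binary.PropositionalEquality using (_≡_; _≢_)
open import Relation.Binary.Construct.Closure.ReflexiveTransitive using (Star)

record Graph (n : ℕ) : Set₁ where
  field
    Adj   : Fin n → Fin n → Set
    sym   : ∀ {u v} → Adj u v → Adj v u
    irrefl : ∀ {u} → ¬ Adj u u
open Graph public

module _ {n : ℕ} (G : Graph n) where

  data Walk : Fin n → Fin n → ℕ → Set where
    here : ∀ {u} → Walk u u zero
    step : ∀ {u w v k} → Adj G u w → Walk w v k → Walk u v (suc k)

  Dist : Fin n → Fin n → ℕ → Set
  Dist u v d = Walk u v d × (∀ k → k < d → ¬ Walk u v k)

  Connected : Set
  Connected = ∀ u v → ∃ λ k → Walk u v k

  Eccentricity : Fin n → ℕ → Set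
  Eccentricity r e = (∀ v → ∃ λ d → Dist r v d × d ≤ e) × (∃ λ v → Dist r v e)

  N₂ : Fin n → Fin n → Set
  N₂ r v = Dist r v 2

  record Matching : Set₁ where
    field
      M       : Fin n → Fin n → Set
      M-adj   : ∀ {u v} → M u v → Adj G u v
      M-sym   : ∀ {u v} → M u v → M v u
      M-func  : ∀ {u v w} → M u v → M u w → v ≡ w

  Saturates : Matching → (Fin n → Set) → Set
  Saturates m S = ∀ v → S v → ∃ λ w → Matching.M m v w

  Config : Set
  Config = Fin n → ℕ

  data Move (C : Config) : Config → Set where
    move : ∀ u v → 1 ≤ C u → 1 ≤ C v → Dist u v (C u) →
           (C' : Config) → C' u ≡ 0 → C' v ≡ C v + C u →
           (∀ w → w ≢ u → w ≢ v → C' w ≡ C w) → Move C C'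

  Reachable : Config → Config → Set
  Reachable = Star Move

  one : Config
  one _ = 1

  AllOn : Fin n → Config → Set
  AllOn r C = C r ≡ n × (∀ v → v ≢ r → C v ≡ 0)

  Stackable : Fin n → Set
  Stackable r = ∃ λ C → Reachable one C × AllOn r C

-- Necessity: a configuration in which r is empty, or in which some vertex other than r
-- carries at least three cups, can never be stacked onto r, since such a stack could only
-- move to a vertex at distance at least 3 and r has eccentricity 2.  Along a successful run
-- every move therefore either goes onto r or puts a single cup onto an adjacent single cup.
-- The latter moves form a matching, and it saturates N₂(r): a single cup on a vertex of
-- N₂(r) cannot move onto r, so every such vertex is emptied by a move of the latter kind.
--
-- Sufficiency: for each x ∈ N₂(r) stack its partner onto x and the resulting two cups
-- onto r; afterwards move every remaining single cup of N₁(r) onto r.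
module Submission where

open import Data.Empty using (⊥; ⊥-elim)
open import Data.Fin using (Fin; _≟_; punchIn)
open import Data.Fin.Properties using (punchInᵢ≢i; ¬Fin0)
open import Data.List using ([]; _∷_; allFin)
open import Data.List.Membership.Propositional using (_∈_)
open import Data.List.Membership.Propositional.Properties using (∈-allFin)
open import Data.List.Relation.Unary.Any using (here; there)
open import Data.Nat using (ℕ; zero; suc; _+_; _≤_; _<_; z≤n; s≤s)
open import Data.Nat.Properties
  using ( +-commutativeSemigroup; +-0-commutativeMonoid; +-comm; +-assoc; +-identityʳ; +-cancelʳ-≡
        ; +-mono-≤; ≤-refl; ≤-trans; m≤m+n; m≤n+m; n≤0⇒n≡0; n≤1⇒n≡0∨n≡1
        ; <-cmp; <⇒≱; >⇒≢; ≰⇒>)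
open import Algebra.Properties.CommutativeSemigroup +-commutativeSemigroup using (xy∙z≈zy∙x)
open import Algebra.Properties.CommutativeMonoid.Sum +-0-commutativeMonoid
  using (sum; sum-remove; sum-cong-≗; sum-replicate-zero)
open import Data.Product using (Σ; ∃; _×_; _,_; proj₁; proj₂)
open import Data.Sum using (_⊎_; inj₁; inj₂; [_,_])
open import Data.Vec.Functional using (updateAt)
open import Data.Vec.Functional.Properties using (updateAt-updates; updateAt-minimal)
open import Defs renaming (sym to Adj-sym)
open import Function using (_∘_; const; case_of_)
open import Function.Bundles using (_⇔_; mk⇔)
open import Relation.Binary using (tri<; tri≈; tri>)
open import Relation.Binary.Construct.Closure.ReflexiveTransitive using (ε; _◅_; _◅◅_)
open import Relation.Binary.PropositionalEquality
  using (_≡_; _≢_; refl; sym; trans; cong; cong₂; subst; ≢-sym; module ≡-Reasoning)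
open import Relation.Nullary using (¬_; yes; no; contradiction)
open import Relation.Unary using (Decidable)

open ≡-Reasoning

sum-agree-off : ∀ {n} (f g : Fin n → ℕ) u → (∀ w → w ≢ u → f w ≡ g w) →
  sum f + g u ≡ sum g + f u
sum-agree-off {suc n} f g u f≈g = begin
  sum f + g u                         ≡⟨ cong (_+ g u) (sum-remove {i = u} f) ⟩
  f u + sum (f ∘ punchIn u) + g u     ≡⟨ cong (λ s → f u + s + g u) (sum-cong-≗ (f≈g _ ∘ punchInᵢ≢i u)) ⟩
  f u + sum (g ∘ punchIn u) + g u     ≡⟨ xy∙z≈zy∙x (f u) _ (g u) ⟩
  g u + sum (g ∘ punchIn u) + f u     ≡⟨ cong (_+ f u) (sum-remove {i = u} g) ⟨
  sum g + f u                         ∎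

sum-concentrated : ∀ {n} (f : Fin n → ℕ) r → (∀ v → v ≢ r → f v ≡ 0) →
  sum f ≡ f r
sum-concentrated {n} f r f≈0 = begin
  sum f                    ≡⟨ +-identityʳ (sum f) ⟨
  sum f + 0                ≡⟨ sum-agree-off f (const 0) r f≈0 ⟩
  sum {n} (const 0) + f r  ≡⟨ cong (_+ f r) (sum-replicate-zero n) ⟩
  f r                      ∎

sum-ones : ∀ n → sum {n} (const 1) ≡ n
sum-ones zero    = refl
sum-ones (suc n) = cong suc (sum-ones n)

both-one : ∀ {a b} → 1 ≤ a → 1 ≤ b → a + b < 3 → a ≡ 1 × b ≡ 1
both-one {suc zero}    {suc zero}    _ _   _     = refl , refl
both-one {suc zero}    {suc (suc _)} _ _   (s≤s (s≤s (s≤s ())))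
both-one {suc (suc _)} {_}           _ 1≤b a+b<3 =
  contradiction (+-mono-≤ (s≤s (s≤s z≤n)) 1≤b) (<⇒≱ a+b<3)

≡suc⇒≥1 : ∀ {a b} → a ≡ suc b → 1 ≤ a
≡suc⇒≥1 refl = s≤s z≤n

module _ {n : ℕ} (G : Graph n) where

  walk-snoc : ∀ {u v w k} → Walk G u v k → Adj G v w → Walk G u w (suc k)
  walk-snoc here       vw = step vw here
  walk-snoc (step a p) vw = step a (walk-snoc p vw)

  walk-reverse : ∀ {u v k} → Walk G u v k → Walk G v u k
  walk-reverse here       = here
  walk-reverse (step a p) = walk-snoc (walk-reverse p) (Adj-sym G a)

  walk-zero : ∀ {u v} → Walk G u v 0 → u ≡ v
  walk-zero here = refl

  walk-one : ∀ {u v} → Walk G u v 1 → Adj G u v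
  walk-one (step a here) = a

  Dist-sym : ∀ {u v d} → Dist G u v d → Dist G v u d
  Dist-sym (p , shortest) = walk-reverse p , λ k k<d q → shortest k k<d (walk-reverse q)

  Dist-unique : ∀ {u v d d′} → Dist G u v d → Dist G u v d′ → d ≡ d′
  Dist-unique {d = d} {d′} (p , shortest) (p′ , shortest′) with <-cmp d d′
  ... | tri< d<d′ _ _ = contradiction p (shortest′ d d<d′)
  ... | tri≈ _ d≡d′ _ = d≡d′
  ... | tri> _ _ d′<d = contradiction p′ (shortest d′ d′<d)

  Dist⇒≢ : ∀ {u v d} → 1 ≤ d → Dist G u v d → u ≢ v
  Dist⇒≢ 1≤d (_ , shortest) refl = shortest 0 1≤d here

  Adj⇒Dist-one : ∀ {u v} → Adj G u v → Dist G u v 1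
  Adj⇒Dist-one uv = step uv here , shortest
    where
    shortest : ∀ k → k < 1 → ¬ Walk G _ _ k
    shortest zero    _             p = irrefl G (subst (Adj G _) (sym (walk-zero p)) uv)
    shortest (suc _) (s≤s ())

  stack : Config G → Fin n → Fin n → Config G
  stack C u v = updateAt (updateAt C u (const 0)) v (_+ C u)

  stack-source : ∀ C {u v} → u ≢ v → stack C u v u ≡ 0
  stack-source C {u} {v} u≢v = trans (updateAt-minimal u v _ u≢v) (updateAt-updates u C)

  stack-target : ∀ C {u v} → u ≢ v → stack C u v v ≡ C v + C u
  stack-target C {u} {v} u≢v =
    trans (updateAt-updates v _) (cong (_+ C u) (updateAt-minimal v u C (≢-sym u≢v)))

  stack-other : ∀ C {u v w} → w ≢ u → w ≢ v → stack C u v w ≡ C w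
  stack-other C {u} {v} {w} w≢u w≢v = trans (updateAt-minimal w v _ w≢v) (updateAt-minimal w u C w≢u)

  stack-move : ∀ C {u v} → 1 ≤ C u → 1 ≤ C v → Dist G u v (C u) → Move G C (stack C u v)
  stack-move C {u} {v} Cu≥1 Cv≥1 d =
    move u v Cu≥1 Cv≥1 d _ (stack-source C u≢v) (stack-target C u≢v) (λ _ → stack-other C)
    where u≢v = Dist⇒≢ Cu≥1 d

  move-preserves-sum : ∀ {C C′} → Move G C C′ → sum C′ ≡ sum C
  move-preserves-sum {C} (move u v Cu≥1 _ d C′ C′u≡0 C′v≡ C′≡) = +-cancelʳ-≡ (C v) _ _ (begin
    sum C′ + C v           ≡⟨ cong (sum C′ +_) (updateAt-minimal v u C (≢-sym u≢v)) ⟨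
    sum C′ + h v           ≡⟨ sum-agree-off C′ h v C′≈h ⟩
    sum h + C′ v           ≡⟨ cong (sum h +_) (trans C′v≡ (+-comm (C v) (C u))) ⟩
    sum h + (C u + C v)    ≡⟨ +-assoc (sum h) (C u) (C v) ⟨
    sum h + C u + C v      ≡⟨ cong (_+ C v) (sum-agree-off h C u λ w → updateAt-minimal w u C) ⟩
    sum C + h u + C v      ≡⟨ cong (λ x → sum C + x + C v) (updateAt-updates u C) ⟩
    sum C + 0 + C v        ≡⟨ cong (_+ C v) (+-identityʳ (sum C)) ⟩
    sum C + C v            ∎)
    where
    u≢v = Dist⇒≢ Cu≥1 d
    h = updateAt C u (const 0)
    C′≈h : ∀ w → w ≢ v → C′ w ≡ h w
    C′≈h w w≢v with w ≟ u
    ... | yes refl = trans C′u≡0 (sym (updateAt-updates w C))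
    ... | no w≢u   = trans (C′≡ w w≢u w≢v) (sym (updateAt-minimal w u C w≢u))

  reachable-preserves-sum : ∀ {C C′} → Reachable G C C′ → sum C′ ≡ sum C
  reachable-preserves-sum ε          = refl
  reachable-preserves-sum (mv ◅ mvs) = trans (reachable-preserves-sum mvs) (move-preserves-sum mv)

  Unmatched : Matching G → Fin n → Set
  Unmatched m x = ∀ y → ¬ Matching.M m x y

  emptyMatching : Matching G
  emptyMatching = record { M = λ _ _ → ⊥ ; M-adj = λ () ; M-sym = λ () ; M-func = λ () }

  addEdge : (m : Matching G) {u v : Fin n} → Adj G u v → Unmatched m u → Unmatched m v → Matching G
  addEdge m {u} {v} uv u-free v-free = record { M = M′ ; M-adj = adj ; M-sym = symm ; M-func = func }
    where
    open Matching m
    M′ : Fin n → Fin n → Set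
    M′ x y = M x y ⊎ (x ≡ u × y ≡ v) ⊎ (x ≡ v × y ≡ u)
    adj : ∀ {x y} → M′ x y → Adj G x y
    adj (inj₁ xy)                   = M-adj xy
    adj (inj₂ (inj₁ (refl , refl))) = uv
    adj (inj₂ (inj₂ (refl , refl))) = Adj-sym G uv
    symm : ∀ {x y} → M′ x y → M′ y x
    symm (inj₁ xy)                   = inj₁ (M-sym xy)
    symm (inj₂ (inj₁ (refl , refl))) = inj₂ (inj₂ (refl , refl))
    symm (inj₂ (inj₂ (refl , refl))) = inj₂ (inj₁ (refl , refl))
    u≢v : u ≢ v
    u≢v u≡v = irrefl G (subst (Adj G u) (sym u≡v) uv)
    func : ∀ {x y w} → M′ x y → M′ x w → y ≡ w
    func (inj₁ xy)                   (inj₁ xw)                   = M-func xy xw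
    func (inj₁ xy)                   (inj₂ (inj₁ (refl , _)))    = ⊥-elim (u-free _ xy)
    func (inj₁ xy)                   (inj₂ (inj₂ (refl , _)))    = ⊥-elim (v-free _ xy)
    func (inj₂ (inj₁ (refl , _)))    (inj₁ xw)                   = ⊥-elim (u-free _ xw)
    func (inj₂ (inj₂ (refl , _)))    (inj₁ xw)                   = ⊥-elim (v-free _ xw)
    func (inj₂ (inj₁ (_ , refl)))    (inj₂ (inj₁ (_ , refl)))    = refl
    func (inj₂ (inj₂ (_ , refl)))    (inj₂ (inj₂ (_ , refl)))    = refl
    func (inj₂ (inj₁ (refl , _)))    (inj₂ (inj₂ (x≡v , _)))     = contradiction x≡v u≢v
    func (inj₂ (inj₂ (refl , _)))    (inj₂ (inj₁ (x≡u , _)))     = contradiction (sym x≡u) u≢v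

  addEdge-unmatched : ∀ m {u v x} (uv : Adj G u v) u-free v-free → x ≢ u → x ≢ v →
    Unmatched m x → Unmatched (addEdge m uv u-free v-free) x
  addEdge-unmatched m _ _ _ x≢u x≢v x-free y = [ x-free y , [ x≢u ∘ proj₁ , x≢v ∘ proj₁ ] ]

module Rooted {n : ℕ} (G : Graph n) (r : Fin n) (ecc : Eccentricity G r 2) where

  N₁ : Fin n → Set
  N₁ x = Dist G r x 1

  N₁⇒≢r : ∀ {x} → N₁ x → x ≢ r
  N₁⇒≢r x∈N₁ = ≢-sym (Dist⇒≢ G ≤-refl x∈N₁)

  N₂⇒≢r : ∀ {x} → N₂ G r x → x ≢ r
  N₂⇒≢r x∈N₂ = ≢-sym (Dist⇒≢ G (s≤s z≤n) x∈N₂)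

  data Layer (x : Fin n) : Set where
    root   : x ≡ r → Layer x
    layer₁ : N₁ x → Layer x
    layer₂ : N₂ G r x → Layer x

  layer : ∀ x → Layer x
  layer x with proj₁ ecc x
  ... | 0           , (p , _) , _ = root (sym (walk-zero G p))
  ... | 1           , d       , _ = layer₁ d
  ... | 2           , d       , _ = layer₂ d
  ... | suc (suc (suc _)) , _ , s≤s (s≤s ())

  N₁? : Decidable N₁
  N₁? x with layer x
  ... | root refl = no λ x∈N₁ → N₁⇒≢r x∈N₁ refl
  ... | layer₁ d  = yes d
  ... | layer₂ d  = no λ d′ → contradiction (Dist-unique G d′ d) λ ()

  N₂? : Decidable (N₂ G r)
  N₂? x with layer x
  ... | root refl = no λ x∈N₂ → N₂⇒≢r x∈N₂ refl
  ... | layer₁ d  = no λ d′ → contradiction (Dist-unique G d d′) λ ()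
  ... | layer₂ d  = yes d

  dist-to-root≤2 : ∀ {u k} → Dist G u r k → k ≤ 2
  dist-to-root≤2 {u} d with proj₁ ecc u
  ... | _ , d′ , d′≤2 = subst (_≤ 2) (Dist-unique G d′ (Dist-sym G d)) d′≤2

  occupied⇒≢ : ∀ {C : Config G} {u w} → 1 ≤ C u → C w ≡ 0 → w ≢ u
  occupied⇒≢ {C} Cu≥1 Cw≡0 refl with subst (1 ≤_) Cw≡0 Cu≥1
  ... | ()

  N₂-neighbour≢r : ∀ {x y} → N₂ G r x → Adj G x y → y ≢ r
  N₂-neighbour≢r x∈N₂ xy refl = contradiction (Dist-unique G (Adj⇒Dist-one G (Adj-sym G xy)) x∈N₂) λ ()

  -- A stack of at least three cups can only move to vertices at distance at least 3,
  -- so it never reaches r again.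
  Doomed : Config G → Set
  Doomed C = C r ≡ 0 ⊎ ∃ λ u → u ≢ r × 3 ≤ C u

  move-Doomed : ∀ {C C′} → Move G C C′ → Doomed C → Doomed C′
  move-Doomed (move u v Cu≥1 Cv≥1 _ _ _ _ C′≡) (inj₁ Cr≡0) =
    inj₁ (trans (C′≡ r (occupied⇒≢ Cu≥1 Cr≡0) (occupied⇒≢ Cv≥1 Cr≡0)) Cr≡0)
  move-Doomed {C} (move u v _ _ d _ _ C′v≡ C′≡) (inj₂ (w , w≢r , 3≤Cw)) with w ≟ u | w ≟ v
  ... | yes refl | _ = inj₂ (v , v≢r , subst (3 ≤_) (sym C′v≡) (≤-trans 3≤Cw (m≤n+m (C w) (C v))))
    where
    v≢r : v ≢ r
    v≢r refl = contradiction (dist-to-root≤2 d) (<⇒≱ 3≤Cw)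
  ... | no _ | yes refl = inj₂ (w , w≢r , subst (3 ≤_) (sym C′v≡) (≤-trans 3≤Cw (m≤m+n (C w) (C u))))
  ... | no w≢u | no w≢v = inj₂ (w , w≢r , subst (3 ≤_) (sym (C′≡ w w≢u w≢v)) 3≤Cw)

  reachable-Doomed : ∀ {C D} → Reachable G C D → Doomed C → Doomed D
  reachable-Doomed ε          = λ doomed → doomed
  reachable-Doomed (mv ◅ mvs) = reachable-Doomed mvs ∘ move-Doomed mv

  stacked-not-Doomed : ∀ {D} → AllOn G r D → ¬ Doomed D
  stacked-not-Doomed (Dr≡n , _)    (inj₁ Dr≡0)             = ¬Fin0 (subst Fin (trans (sym Dr≡n) Dr≡0) r)
  stacked-not-Doomed (_ , others≡0) (inj₂ (u , u≢r , 3≤Du)) with subst (3 ≤_) (others≡0 u u≢r) 3≤Du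
  ... | ()

  -- m records the moves of a single cup onto a single cup made so far.
  record PairedBy (C : Config G) (m : Matching G) : Set where
    field
      single⇒unmatched : ∀ x → C x ≡ 1 → Unmatched G m x
      N₂-covered       : ∀ x → N₂ G r x → C x ≡ 1 ⊎ ∃ (Matching.M m x)

  move-PairedBy : ∀ {C C′ m} → Move G C C′ → ¬ Doomed C′ → PairedBy C m →
    Σ (Matching G) (PairedBy C′)
  move-PairedBy {C} {m = m} (move u v Cu≥1 Cv≥1 d C′ C′u≡0 C′v≡ C′≡) alive P =
    case v ≟ r of λ { (yes v≡r) → m , onto-root v≡r ; (no v≢r) → pair-up v≢r }
    where
    module P = PairedBy P

    still-single : ∀ x → C′ x ≡ 1 → x ≢ u × x ≢ v × C x ≡ 1
    still-single x C′x≡1 with x ≟ u | x ≟ v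
    ... | yes refl | _        = contradiction (trans (sym C′u≡0) C′x≡1) λ ()
    ... | no _     | yes refl = contradiction (trans (sym C′v≡) C′x≡1) (>⇒≢ (+-mono-≤ Cv≥1 Cu≥1))
    ... | no x≢u   | no x≢v   = x≢u , x≢v , trans (sym (C′≡ x x≢u x≢v)) C′x≡1

    onto-root : v ≡ r → PairedBy C′ m
    onto-root v≡r = record
      { single⇒unmatched = λ x → P.single⇒unmatched x ∘ proj₂ ∘ proj₂ ∘ still-single x
      ; N₂-covered       = covered }
      where
      covered : ∀ x → N₂ G r x → C′ x ≡ 1 ⊎ ∃ (Matching.M m x)
      covered x x∈N₂ with P.N₂-covered x x∈N₂ | x ≟ u | x ≟ v
      ... | inj₂ matched | _ | _ = inj₂ matched
      ... | inj₁ Cx≡1 | yes refl | _ =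
        contradiction (Dist-unique G (subst (λ w → Dist G x w (C x)) v≡r d) (Dist-sym G x∈N₂))
                      (subst (_≢ 2) (sym Cx≡1) λ ())
      ... | inj₁ _ | no _ | yes x≡v = contradiction (trans x≡v v≡r) (N₂⇒≢r x∈N₂)
      ... | inj₁ Cx≡1 | no x≢u | no x≢v = inj₁ (trans (C′≡ x x≢u x≢v) Cx≡1)

    pair-up : v ≢ r → Σ (Matching G) (PairedBy C′)
    pair-up v≢r = m′ , record { single⇒unmatched = single⇒unmatched ; N₂-covered = covered }
      where
      C′v<3 : C′ v < 3
      C′v<3 = ≰⇒> λ 3≤C′v → alive (inj₂ (v , v≢r , 3≤C′v))
      singles = both-one Cv≥1 Cu≥1 (subst (_< 3) C′v≡ C′v<3)
      Cu≡1 = proj₂ singles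
      uv : Adj G u v
      uv = walk-one G (subst (Walk G u v) Cu≡1 (proj₁ d))
      u-free = P.single⇒unmatched u Cu≡1
      v-free = P.single⇒unmatched v (proj₁ singles)
      m′ = addEdge G m uv u-free v-free
      single⇒unmatched : ∀ x → C′ x ≡ 1 → Unmatched G m′ x
      single⇒unmatched x C′x≡1 =
        let x≢u , x≢v , Cx≡1 = still-single x C′x≡1
        in  addEdge-unmatched G m uv u-free v-free x≢u x≢v (P.single⇒unmatched x Cx≡1)
      covered : ∀ x → N₂ G r x → C′ x ≡ 1 ⊎ ∃ (Matching.M m′ x)
      covered x x∈N₂ with x ≟ u | x ≟ v
      ... | yes refl | _        = inj₂ (v , inj₂ (inj₁ (refl , refl)))
      ... | no _     | yes refl = inj₂ (u , inj₂ (inj₂ (refl , refl)))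
      ... | no x≢u   | no x≢v   with P.N₂-covered x x∈N₂
      ...   | inj₁ Cx≡1      = inj₁ (trans (C′≡ x x≢u x≢v) Cx≡1)
      ...   | inj₂ (y , xy)  = inj₂ (y , inj₁ xy)

  initial-PairedBy : PairedBy (one G) (emptyMatching G)
  initial-PairedBy = record { single⇒unmatched = λ _ _ _ () ; N₂-covered = λ _ _ → inj₁ refl }

  run-PairedBy : ∀ {C D m} → Reachable G C D → AllOn G r D → PairedBy C m → Σ (Matching G) (PairedBy D)
  run-PairedBy ε          _       P = _ , P
  run-PairedBy (mv ◅ mvs) stacked P =
    let m′ , P′ = move-PairedBy mv (stacked-not-Doomed stacked ∘ reachable-Doomed mvs) P
    in  run-PairedBy mvs stacked P′

  necessity : Stackable G r → Σ (Matching G) (λ m → Saturates G m (N₂ G r))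
  necessity (_ , reach , stacked) with run-PairedBy reach stacked initial-PairedBy
  ... | m , P = m , saturated
    where
    saturated : Saturates G m (N₂ G r)
    saturated x x∈N₂ with PairedBy.N₂-covered P x x∈N₂
    ... | inj₂ matched = matched
    ... | inj₁ Dx≡1    = contradiction (trans (sym Dx≡1) (proj₂ stacked x (N₂⇒≢r x∈N₂))) λ ()

  module Sufficiency (m : Matching G) (saturates : Saturates G m (N₂ G r)) where
    open Matching m

    _⊑_ : Config G → Config G → Set
    C′ ⊑ C = ∀ v → v ≢ r → C′ v ≤ C v

    ⊑-trans : ∀ {C C′ C″} → C″ ⊑ C′ → C′ ⊑ C → C″ ⊑ C
    ⊑-trans C″⊑C′ C′⊑C v v≢r = ≤-trans (C″⊑C′ v v≢r) (C′⊑C v v≢r)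

    ⊑-empty : ∀ {C C′ x} → C′ ⊑ C → x ≢ r → C x ≡ 0 → C′ x ≡ 0
    ⊑-empty C′⊑C x≢r Cx≡0 = n≤0⇒n≡0 (subst (_ ≤_) Cx≡0 (C′⊑C _ x≢r))

    record Progress (Inv : Config G → Set) (C : Config G) (S : Fin n → Set) : Set where
      field
        final   : Config G
        reach   : Reachable G C final
        inv     : Inv final
        shrinks : final ⊑ C
        clears  : ∀ x → S x → final x ≡ 0
    open Progress

    stay : ∀ {Inv C S} → Inv C → (∀ x → S x → C x ≡ 0) → Progress Inv C S
    stay i empty = record { final = _ ; reach = ε ; inv = i ; shrinks = λ _ _ → ≤-refl ; clears = empty }

    weaken : ∀ {Inv C S T} → (∀ x → T x → S x) → Progress Inv C S → Progress Inv C T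
    weaken T⊆S p = record
      { final   = final p
      ; reach   = reach p
      ; inv     = inv p
      ; shrinks = shrinks p
      ; clears  = λ x → clears p x ∘ T⊆S x }

    andThen : ∀ {Inv C S T} → (∀ {x} → S x → x ≢ r) →
      Progress Inv C S → (∀ {C′} → Inv C′ → Progress Inv C′ T) → Progress Inv C (λ x → S x ⊎ T x)
    andThen S⇒≢r p q = record
      { final   = final p′
      ; reach   = reach p ◅◅ reach p′
      ; inv     = inv p′
      ; shrinks = ⊑-trans (shrinks p′) (shrinks p)
      ; clears  = λ x → [ (λ s → ⊑-empty (shrinks p′) (S⇒≢r s) (clears p x s)) , clears p′ x ] }
      where p′ = q (inv p)

    sweep : ∀ {Inv} {L : Fin n → Set} → Decidable L → (∀ {x} → L x → x ≢ r) →
      (∀ {x} → L x → ∀ {C} → Inv C → Progress Inv C (_≡ x)) →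
      ∀ {C} → Inv C → Progress Inv C L
    sweep {Inv} {L} L? L⇒≢r clear i = weaken (λ x Lx → ∈-allFin x , Lx) (go (allFin n) i)
      where
      go : ∀ xs {C} → Inv C → Progress Inv C (λ x → x ∈ xs × L x)
      go []       i = stay i λ _ ()
      go (x ∷ xs) i with L? x
      ... | yes Lx = weaken split (andThen (λ { refl → L⇒≢r Lx }) (clear Lx i) (go xs))
        where
        split : ∀ y → y ∈ x ∷ xs × L y → y ≡ x ⊎ y ∈ xs × L y
        split _ (here y≡x , _)  = inj₁ y≡x
        split _ (there y∈xs , Ly) = inj₂ (y∈xs , Ly)
      ... | no ¬Lx = weaken skip (go xs i)
        where
        skip : ∀ y → y ∈ x ∷ xs × L y → y ∈ xs × L y
        skip _ (here refl , Lx)  = contradiction Lx ¬Lx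
        skip _ (there y∈xs , Ly) = y∈xs , Ly

    Thin : Config G → Set
    Thin C = 1 ≤ C r × C ⊑ one G

    PartnersReady : Config G → Set
    PartnersReady C = ∀ {x y} → N₂ G r x → M x y → C x ≡ 1 → C y ≡ 1

    Empties : Config G → Config G → Fin n → Fin n → Set
    Empties C C′ x y = C′ x ≡ 0 × C′ y ≡ 0 × (∀ w → w ≢ x → w ≢ y → w ≢ r → C′ w ≡ C w)

    empties-⊑ : ∀ {C C′ x y} → Empties C C′ x y → C′ ⊑ C
    empties-⊑ {C} {x = x} {y} (C′x≡0 , C′y≡0 , C′≡) w w≢r with w ≟ x | w ≟ y
    ... | yes refl | _        = subst (_≤ C w) (sym C′x≡0) z≤n
    ... | no _     | yes refl = subst (_≤ C w) (sym C′y≡0) z≤n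
    ... | no w≢x   | no w≢y   = subst (_≤ C w) (sym (C′≡ w w≢x w≢y w≢r)) ≤-refl

    empties-ready : ∀ {C C′ x y} → M x y → Empties C C′ x y → PartnersReady C → PartnersReady C′
    empties-ready {x = x} {y} xy (C′x≡0 , C′y≡0 , C′≡) ready {a} {b} a∈N₂ ab C′a≡1
      with a ≟ x | a ≟ y
    ... | yes refl | _        = contradiction (trans (sym C′x≡0) C′a≡1) λ ()
    ... | no _     | yes refl = contradiction (trans (sym C′y≡0) C′a≡1) λ ()
    ... | no a≢x   | no a≢y   = trans (C′≡ b b≢x b≢y b≢r) (ready a∈N₂ ab Ca≡1)
      where
      Ca≡1 = trans (sym (C′≡ a a≢x a≢y (N₂⇒≢r a∈N₂))) C′a≡1
      b≢x : b ≢ x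
      b≢x refl = a≢y (M-func (M-sym ab) xy)
      b≢y : b ≢ y
      b≢y refl = a≢x (M-func (M-sym ab) (M-sym xy))
      b≢r = N₂-neighbour≢r a∈N₂ (M-adj ab)

    empties-Thin : ∀ {C C′ x y} → Empties C C′ x y → 1 ≤ C′ r → Thin C → Thin C′
    empties-Thin emptied C′r≥1 (_ , C⊑1) = C′r≥1 , ⊑-trans (empties-⊑ emptied) C⊑1

    stack-onto-root : ∀ C {x} → x ≢ r → 1 ≤ C r → Empties C (stack G C x r) x x × 1 ≤ stack G C x r r
    stack-onto-root C {x} x≢r Cr≥1 =
      (source , source , λ w w≢x _ w≢r → stack-other G C w≢x w≢r) ,
      subst (1 ≤_) (sym (stack-target G C x≢r)) (≤-trans Cr≥1 (m≤m+n (C r) (C x)))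
      where source = stack-source G C x≢r

    clear-N₁ : ∀ {x} → N₁ x → ∀ {C} → Thin C → Progress Thin C (_≡ x)
    clear-N₁ {x} x∈N₁ {C} thin@(Cr≥1 , C⊑1) with n≤1⇒n≡0∨n≡1 (C⊑1 x (N₁⇒≢r x∈N₁))
    ... | inj₁ Cx≡0 = stay thin λ { _ refl → Cx≡0 }
    ... | inj₂ Cx≡1 = record
      { final   = stack G C x r
      ; reach   = stack-move G C (≡suc⇒≥1 Cx≡1) Cr≥1 x→r ◅ ε
      ; inv     = empties-Thin emptied (proj₂ onto-root) thin
      ; shrinks = empties-⊑ emptied
      ; clears  = λ { _ refl → proj₁ emptied } }
      where
      x→r : Dist G x r (C x)
      x→r = subst (Dist G x r) (sym Cx≡1) (Dist-sym G x∈N₁)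
      onto-root = stack-onto-root C (N₁⇒≢r x∈N₁) Cr≥1
      emptied   = proj₁ onto-root

    clear-N₂ : ∀ {x} → N₂ G r x → ∀ {C} → Thin C × PartnersReady C →
      Progress (λ C → Thin C × PartnersReady C) C (_≡ x)
    clear-N₂ {x} x∈N₂ {C} (thin@(Cr≥1 , C⊑1) , ready) with n≤1⇒n≡0∨n≡1 (C⊑1 x (N₂⇒≢r x∈N₂))
    ... | inj₁ Cx≡0 = stay (thin , ready) λ { _ refl → Cx≡0 }
    ... | inj₂ Cx≡1 = record
      { final   = C₂
      ; reach   = stack-move G C  (≡suc⇒≥1 Cy≡1)  (≡suc⇒≥1 Cx≡1) y→x
                ◅ stack-move G C₁ (≡suc⇒≥1 C₁x≡2) C₁r≥1          x→r
                ◅ ε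
      ; inv     = empties-Thin emptied C₂r≥1 thin , empties-ready xy emptied ready
      ; shrinks = empties-⊑ emptied
      ; clears  = λ { _ refl → proj₁ emptied } }
      where
      x≢r = N₂⇒≢r x∈N₂
      y   = proj₁ (saturates x x∈N₂)
      xy  = proj₂ (saturates x x∈N₂)
      y≢x : y ≢ x
      y≢x y≡x = irrefl G (subst (Adj G x) y≡x (M-adj xy))
      y≢r = N₂-neighbour≢r x∈N₂ (M-adj xy)
      Cy≡1 = ready x∈N₂ xy Cx≡1
      y→x : Dist G y x (C y)
      y→x = subst (Dist G y x) (sym Cy≡1) (Adj⇒Dist-one G (Adj-sym G (M-adj xy)))
      C₁ = stack G C y x
      C₁x≡2 : C₁ x ≡ 2
      C₁x≡2 = trans (stack-target G C y≢x) (cong₂ _+_ Cx≡1 Cy≡1)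
      C₁r≥1 : 1 ≤ C₁ r
      C₁r≥1 = subst (1 ≤_) (sym (stack-other G C (≢-sym y≢r) (≢-sym x≢r))) Cr≥1
      x→r : Dist G x r (C₁ x)
      x→r = subst (Dist G x r) (sym C₁x≡2) (Dist-sym G x∈N₂)
      C₂ = stack G C₁ x r
      C₂-onto-root = stack-onto-root C₁ x≢r C₁r≥1
      C₂r≥1 = proj₂ C₂-onto-root
      emptied : Empties C C₂ x y
      emptied = proj₁ (proj₁ C₂-onto-root)
              , trans (stack-other G C₁ y≢x y≢r) (stack-source G C y≢x)
              , λ w w≢x w≢y w≢r → trans (stack-other G C₁ w≢x w≢r) (stack-other G C w≢y w≢x)

    sufficiency : Stackable G r
    sufficiency = final p₂ , reach p₁ ◅◅ reach p₂ , root-full , others-empty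
      where
      p₁ = sweep N₂? N₂⇒≢r clear-N₂ ((≤-refl , λ _ _ → ≤-refl) , λ _ _ _ → refl)
      p₂ = sweep N₁? N₁⇒≢r clear-N₁ (proj₁ (inv p₁))
      others-empty : ∀ v → v ≢ r → final p₂ v ≡ 0
      others-empty v v≢r with layer v
      ... | root v≡r  = contradiction v≡r v≢r
      ... | layer₁ d  = clears p₂ v d
      ... | layer₂ d  = ⊑-empty (shrinks p₂) v≢r (clears p₁ v d)
      root-full : final p₂ r ≡ n
      root-full = begin
        final p₂ r      ≡⟨ sum-concentrated (final p₂) r others-empty ⟨
        sum (final p₂)  ≡⟨ reachable-preserves-sum G (reach p₁ ◅◅ reach p₂) ⟩
        sum (one G)     ≡⟨ sum-ones n ⟩
        n               ∎

-- Connectivity is implied by the eccentricity hypothesis.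
lemma10 : {n : ℕ} (G : Graph n) (r : Fin n) → Connected G → Eccentricity G r 2 →
    (Stackable G r ⇔ Σ (Matching G) (λ m → Saturates G m (N₂ G r)))
lemma10 G r _ ecc = mk⇔ necessity λ (m , saturates) → Sufficiency.sufficiency m saturates
  where open Rooted G r ecc
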